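{- Let $n,t,\lambda,s_1,s_2$ be positive integers with $n>t>1$ and $\min\{s_1+1,s_2+1\}\le\lambda\le s_1+s_2$, and set $\chi=\max\{\lceil t/s_1\rceil,\lceil (n-t)/s_2\rceil\}$. For $a\in\mathbb{Z}_n$ let $T(a)=\{a,a+1,\dots,a+t-1\}\subseteq\mathbb{Z}_n$ (arithmetic modulo $n$), and let $\mathcal{T}=\{T(a):a\in\mathbb{Z}_n\}$. Suppose $\mathcal{S}\subseteq\mathcal{T}$ is such that no $A_1,\dots,A_\lambda\in\mathcal{S}$ (not necessarily distinct) form an $(s_1+1,s_2+1)$-disjoint sequence of subsets of $\mathbb{Z}_n$. Then \[|\mathcal{S}|\le(\lambda-1)\left\lceil\frac{n}{\lfloor n/\chi\rfloor}\right\rceil.\]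
   Context: $\mathbb{Z}_n$ is the set of integers modulo $n$. A sequence $A_1,\dots,A_\lambda$ of subsets of a ground set $X$ (repetitions allowed) is $(k_1,k_2)$-disjoint if $\bigcap_{i\in B}A_i=\emptyset$ for every $k_1$-subset $B\subseteq\{1,\dots,\lambda\}$ and $\bigcup_{i\in B}A_i=X$ for every $k_2$-subset $B\subseteq\{1,\dots,\lambda\}$ (each condition vacuous if the subset size exceeds $\lambda$). Here $X=\mathbb{Z}_n$. -}

module Defs where

open import Data.Nat using (ℕ; zero; suc; _+_; _∸_; _/_; _⊔_)
open import Data.Nat.DivMod using (_mod_)
open import Data.Fin using (Fin; toℕ)
open import Data.Fin.Properties using (_≟_)
open import Data.Fin.Subset using (Subset; _∈_; ∣_∣)
open import Data.Vec using (tabulate)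
open import Data.List using (List; upTo)
open import Data.Bool.ListAction using (any)
open import Data.Product using (∃-syntax; _×_)
open import Relation.Nullary.Decidable using (⌊_⌋)
open import Relation.Nullary using (¬_)
open import Relation.Binary.PropositionalEquality using (_≡_)

floorDiv : ℕ → ℕ → ℕ
floorDiv a zero    = 0
floorDiv a (suc b) = a / suc b

-- Total ceiling division: ⌈a/b⌉ (value 0 when b = 0; only used with b ≥ 1).
ceilDiv : ℕ → ℕ → ℕ
ceilDiv a zero    = 0
ceilDiv a (suc b) = (a + b) / suc b

shift : ∀ {n} → Fin n → ℕ → Fin n
shift {suc m} a k = (toℕ a + k) mod (suc m)

T : ∀ {n} (t : ℕ) → Fin n → Subset n
T t a = tabulate (λ x → any (λ k → ⌊ shift a k ≟ x ⌋) (upTo t))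

Disjoint : ∀ {n l} (k₁ k₂ : ℕ) → (Fin l → Subset n) → Set
Disjoint {n} {λ'} k₁ k₂ A =
  ((B : Subset λ') → ∣ B ∣ ≡ k₁ → (x : Fin n) → ¬ ((i : Fin λ') → i ∈ B → x ∈ A i))
  × ((B : Subset λ') → ∣ B ∣ ≡ k₂ → (x : Fin n) → ∃[ i ] (i ∈ B × x ∈ A i))

module Submission where

-- Put m = ⌊n/χ⌋ and give a ∈ ℤ_n the class ⌊(a m mod n)/m⌋, the block of length m containing a m;
-- there are ⌈n/m⌉ classes. Multiplication by m turns a cyclic distance d ∈ [1, χ) into d m ∈ [m, n - m],
-- and points at such a distance never share a block; so distinct starts in one class are at cyclic
-- distance at least χ.
-- For any point x, the offsets x - a of such starts are then χ-separated, so at most ⌈t/χ⌉ ≤ s₁ of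
-- them lie in [0, t) (the intervals T(a) containing x) and at most ⌈(n - t)/χ⌉ ≤ s₂ lie in [t, n).
-- Hence any λ distinct intervals from one class form an (s₁+1, s₂+1)-disjoint sequence, and each
-- class meets 𝒮 in at most λ - 1 members.

open import Defs
open import Data.Nat
  using (ℕ; zero; suc; NonZero; >-nonZero; _≤_; _<_; _+_; _∸_; _*_; _/_; _%_; _⊓_; _⊔_; _≟_; _≤?_; _<?_; z≤n; s≤s)
open import Data.Nat.Properties
open import Data.Nat.DivMod
open import Data.Fin using (Fin; zero; suc; toℕ; fromℕ<; inject≤; punchOut)
open import Data.Fin.Properties
  using (toℕ-fromℕ<; toℕ-injective; toℕ<n; fromℕ<-injective; inject≤-injective; punchOut-injective; any?)
  renaming (suc-injective to Fin-suc-injective; _≟_ to _≟ᶠ_)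
open import Data.Fin.Subset using (Subset; inside; outside; ∣_∣) renaming (_∈_ to _∈ₛ_)
open import Data.Fin.Subset.Properties using (_∈?_)
open import Data.Vec as Vec using ([]; _∷_)
open import Data.Vec.Properties using ([]=⇒lookup; lookup⇒[]=; lookup∘tabulate)
open import Data.Bool using (Bool; true)
open import Data.Bool.Properties using (T-≡)
open import Data.Bool.ListAction using (any)
open import Data.List using (List; []; _∷_; length; filter; map; lookup; upTo)
open import Data.List.Properties using (length-map)
open import Data.List.Membership.Propositional using (_∈_; find; lose)
open import Data.List.Membership.Propositional.Properties using (∈-upTo⁺; ∈-upTo⁻; ∈-lookup; ∈-filter⁻; ∈-map⁺)
open import Data.List.Relation.Unary.All as All using (All; []; _∷_)
open import Data.List.Relation.Unary.All.Properties using (all-filter) renaming (filter⁺ to All-filter⁺)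
open import Data.List.Relation.Unary.Any.Properties using (any⁺; any⁻)
open import Data.List.Relation.Unary.Unique.Propositional using (Unique)
open import Data.List.Relation.Unary.AllPairs using (_∷_)
open import Data.List.Relation.Unary.Unique.Propositional.Properties
  using () renaming (map⁻ to Unique-map⁻; filter⁺ to Unique-filter⁺)
open import Data.List.Relation.Binary.Sublist.Propositional.Properties
  using (filter-⊆; length-mono-≤) renaming (filter⁺ to Sublist-filter⁺)
open import Data.Product using (∃-syntax; _×_; _,_; proj₁; proj₂)
open import Data.Sum using (inj₁; inj₂)
open import Function using (_∘_; Injective; Equivalence)
open import Relation.Nullary using (¬_; yes; no; contradiction)
open import Relation.Nullary.Decidable using (⌊_⌋; toWitness; fromWitness; _×-dec_)
open import Relation.Unary using (Decidable)
open import Relation.Unary.Properties using (∁?)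
open import Relation.Binary.PropositionalEquality
  using (_≡_; _≢_; refl; sym; trans; cong; subst; module ≡-Reasoning)
open import Algebra.Properties.CommutativeSemigroup +-commutativeSemigroup using (x∙yz≈y∙xz; xy∙z≈xz∙y)

injectiveOn⇒∣p∣≤ : ∀ {l s} (p : Subset l) (f : ∀ i → i ∈ₛ p → Fin s) →
  (∀ {i j} (i∈p : i ∈ₛ p) (j∈p : j ∈ₛ p) → f i i∈p ≡ f j j∈p → i ≡ j) → ∣ p ∣ ≤ s
injectiveOn⇒∣p∣≤ [] f f-inj = z≤n
injectiveOn⇒∣p∣≤ (outside ∷ p) f f-inj =
  injectiveOn⇒∣p∣≤ p (λ i → f (suc i) ∘ Vec.there)
    (λ i∈p j∈p → Fin-suc-injective ∘ f-inj (Vec.there i∈p) (Vec.there j∈p))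
injectiveOn⇒∣p∣≤ {s = zero} (inside ∷ p) f f-inj with f zero Vec.here
... | ()
injectiveOn⇒∣p∣≤ {s = suc s} (inside ∷ p) f f-inj = s≤s (injectiveOn⇒∣p∣≤ p f′ f′-inj)
  where
  f₀≢ : ∀ {i} (i∈p : i ∈ₛ p) → f zero Vec.here ≢ f (suc i) (Vec.there i∈p)
  f₀≢ i∈p eq with f-inj Vec.here (Vec.there i∈p) eq
  ... | ()
  f′ : ∀ i → i ∈ₛ p → Fin s
  f′ i i∈p = punchOut (f₀≢ i∈p)
  f′-inj : ∀ {i j} (i∈p : i ∈ₛ p) (j∈p : j ∈ₛ p) → f′ i i∈p ≡ f′ j j∈p → i ≡ j
  f′-inj i∈p j∈p =
    Fin-suc-injective ∘ f-inj (Vec.there i∈p) (Vec.there j∈p) ∘ punchOut-injective (f₀≢ i∈p) (f₀≢ j∈p)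

m≤n∧m/d≡n/d⇒n<m+d : ∀ {a b d} .{{_ : NonZero d}} → a ≤ b → a / d ≡ b / d → b < a + d
m≤n∧m/d≡n/d⇒n<m+d {a} {b} {d} a≤b eq = begin-strict
  b                     ≡⟨ m≡m%n+[m/n]*n b d ⟩
  b % d + (b / d) * d   <⟨ +-monoˡ-< ((b / d) * d) (m%n<n b d) ⟩
  d + (b / d) * d       ≡⟨ cong (λ q → d + q * d) (sym eq) ⟩
  d + (a / d) * d       ≤⟨ +-monoʳ-≤ d (m/n*n≤m a d) ⟩
  d + a                 ≡⟨ +-comm d a ⟩
  a + d                 ∎
  where open ≤-Reasoning

SeparatedOn : ∀ {l} → ℕ → (Fin l → ℕ) → Subset l → Set
SeparatedOn χ u p = ∀ {i j} → i ∈ₛ p → j ∈ₛ p → u i ≤ u j → u j < u i + χ → i ≡ j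

-- Cut [c, c + s χ) into s windows of length χ: a χ-separated family meets each window at most once.
separated⇒∣p∣≤ : ∀ {l} {χ} .{{_ : NonZero χ}} {u : Fin l → ℕ} {p : Subset l} (c s : ℕ) →
  SeparatedOn χ u p → (∀ {i} → i ∈ₛ p → c ≤ u i × u i ∸ c < s * χ) → ∣ p ∣ ≤ s
separated⇒∣p∣≤ {χ = χ} {u} {p} c s separated window = injectiveOn⇒∣p∣≤ p bucket bucket-injective
  where
  bucket : ∀ i → i ∈ₛ p → Fin s
  bucket i i∈p = fromℕ< (m<n*o⇒m/o<n (proj₂ (window i∈p)))

  close : ∀ {i j} → i ∈ₛ p → j ∈ₛ p → u i ≤ u j → (u i ∸ c) / χ ≡ (u j ∸ c) / χ → u j < u i + χ
  close {i} {j} i∈p j∈p ui≤uj eq = begin-strict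
    u j                 ≡⟨ m∸n+n≡m (proj₁ (window j∈p)) ⟨
    u j ∸ c + c         <⟨ +-monoˡ-< c (m≤n∧m/d≡n/d⇒n<m+d (∸-monoˡ-≤ c ui≤uj) eq) ⟩
    u i ∸ c + χ + c     ≡⟨ xy∙z≈xz∙y (u i ∸ c) χ c ⟩
    u i ∸ c + c + χ     ≡⟨ cong (_+ χ) (m∸n+n≡m (proj₁ (window i∈p))) ⟩
    u i + χ             ∎
    where open ≤-Reasoning

  bucket-injective : ∀ {i j} (i∈p : i ∈ₛ p) (j∈p : j ∈ₛ p) → bucket i i∈p ≡ bucket j j∈p → i ≡ j
  bucket-injective {i} {j} i∈p j∈p eq with fromℕ<-injective _ _ _ _ eq | ≤-total (u i) (u j)
  ... | eq′ | inj₁ ui≤uj = separated i∈p j∈p ui≤uj (close i∈p j∈p ui≤uj eq′)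
  ... | eq′ | inj₂ uj≤ui = sym (separated j∈p i∈p uj≤ui (close j∈p i∈p uj≤ui (sym eq′)))

module _ {A : Set} where

  Unique⇒lookup-injective : ∀ {xs : List A} → Unique xs → Injective _≡_ _≡_ (lookup xs)
  Unique⇒lookup-injective (_ ∷ _) {zero} {zero} _ = refl
  Unique⇒lookup-injective (x∉xs ∷ _) {zero} {suc j} eq = contradiction eq (All.lookup x∉xs (∈-lookup j))
  Unique⇒lookup-injective (x∉xs ∷ _) {suc i} {zero} eq = contradiction (sym eq) (All.lookup x∉xs (∈-lookup i))
  Unique⇒lookup-injective (_ ∷ xs!) {suc i} {suc j} eq = cong suc (Unique⇒lookup-injective xs! eq)

  length-filter+length-filter-∁ : ∀ {P : A → Set} (P? : Decidable P) xs →
    length (filter P? xs) + length (filter (∁? P?) xs) ≡ length xs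
  length-filter+length-filter-∁ P? [] = refl
  length-filter+length-filter-∁ P? (x ∷ xs) with P? x
  ... | yes _ = cong suc (length-filter+length-filter-∁ P? xs)
  ... | no  _ = trans (+-suc _ _) (cong suc (length-filter+length-filter-∁ P? xs))

  fibres≤⇒length≤ : (c : A → ℕ) (q k : ℕ) {xs : List A} → All (λ x → c x < q) xs →
    (∀ r → r < q → length (filter (λ x → c x ≟ r) xs) ≤ k) → length xs ≤ q * k
  fibres≤⇒length≤ c zero k {[]} _ _ = z≤n
  fibres≤⇒length≤ c zero k {_ ∷ _} (() ∷ _) _
  fibres≤⇒length≤ c (suc q) k {xs} c<1+q fibre≤ = begin
    length xs                                  ≡⟨ length-filter+length-filter-∁ top? xs ⟨
    length (filter top? xs) + length rest      ≤⟨ +-mono-≤ (fibre≤ q (n<1+n q)) rest≤ ⟩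
    k + q * k                                  ∎
    where
    open ≤-Reasoning
    top? : Decidable (λ x → c x ≡ q)
    top? x = c x ≟ q
    rest : List A
    rest = filter (∁? top?) xs
    c<q : All (λ x → c x < q) rest
    c<q = All.zipWith (λ (lt , ne) → ≤∧≢⇒< (≤-pred lt) ne) (All-filter⁺ (∁? top?) c<1+q , all-filter (∁? top?) xs)
    rest≤ : length rest ≤ q * k
    rest≤ = fibres≤⇒length≤ c q k c<q (λ r r<q → ≤-trans
      (length-mono-≤ (Sublist-filter⁺ (λ x → c x ≟ r) (λ x → c x ≟ r) (λ { refl p → p }) (filter-⊆ (∁? top?) xs)))
      (fibre≤ r (m<n⇒m<1+n r<q)))

module _ {A B : Set} {f : A → B} where

  All-∃≡⇒≡map : ∀ {ys} → All (λ y → ∃[ x ] y ≡ f x) ys → ∃[ xs ] ys ≡ map f xs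
  All-∃≡⇒≡map [] = [] , refl
  All-∃≡⇒≡map ((x , refl) ∷ ps) with xs , refl ← All-∃≡⇒≡map ps = x ∷ xs , refl

[m+n%d]%d≡[m+n]%d : ∀ m n d .{{_ : NonZero d}} → (m + n % d) % d ≡ (m + n) % d
[m+n%d]%d≡[m+n]%d m n d = begin
  (m + n % d) % d            ≡⟨ %-distribˡ-+ m (n % d) d ⟩
  (m % d + n % d % d) % d    ≡⟨ cong (λ z → (m % d + z) % d) (m%n%n≡m%n n d) ⟩
  (m % d + n % d) % d        ≡⟨ %-distribˡ-+ m n d ⟨
  (m + n) % d                ∎
  where open ≡-Reasoning

[m%d+n]%d≡[m+n]%d : ∀ m n d .{{_ : NonZero d}} → (m % d + n) % d ≡ (m + n) % d
[m%d+n]%d≡[m+n]%d m n d = begin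
  (m % d + n) % d            ≡⟨ cong (_% d) (+-comm (m % d) n) ⟩
  (n + m % d) % d            ≡⟨ [m+n%d]%d≡[m+n]%d n m d ⟩
  (n + m) % d                ≡⟨ cong (_% d) (+-comm n m) ⟩
  (m + n) % d                ∎
  where open ≡-Reasoning

[m%d*n]%d≡[m*n]%d : ∀ m n d .{{_ : NonZero d}} → (m % d * n) % d ≡ (m * n) % d
[m%d*n]%d≡[m*n]%d m n d = begin
  (m % d * n) % d            ≡⟨ %-distribˡ-* (m % d) n d ⟩
  (m % d % d * (n % d)) % d  ≡⟨ cong (λ z → (z * (n % d)) % d) (m%n%n≡m%n m d) ⟩
  (m % d * (n % d)) % d      ≡⟨ %-distribˡ-* m n d ⟨
  (m * n) % d                ∎
  where open ≡-Reasoning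

%-cancelʳ-+ : ∀ a b u d .{{_ : NonZero d}} → (a + u) % d ≡ (b + u) % d → a % d ≡ b % d
%-cancelʳ-+ a b u d eq = begin
  a % d                              ≡⟨ via[z+u] a ⟩
  ((a + u) % d + (u * d ∸ u)) % d    ≡⟨ cong (λ z → (z + (u * d ∸ u)) % d) eq ⟩
  ((b + u) % d + (u * d ∸ u)) % d    ≡⟨ via[z+u] b ⟨
  b % d                              ∎
  where
  open ≡-Reasoning
  via[z+u] : ∀ z → z % d ≡ ((z + u) % d + (u * d ∸ u)) % d
  via[z+u] z = begin
    z % d                            ≡⟨ [m+kn]%n≡m%n z u d ⟨
    (z + u * d) % d                  ≡⟨ cong (λ w → (z + w) % d) (m+[n∸m]≡n (m≤m*n u d)) ⟨
    (z + (u + (u * d ∸ u))) % d      ≡⟨ cong (_% d) (+-assoc z u (u * d ∸ u)) ⟨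
    (z + u + (u * d ∸ u)) % d        ≡⟨ [m%d+n]%d≡[m+n]%d (z + u) (u * d ∸ u) d ⟨
    ((z + u) % d + (u * d ∸ u)) % d  ∎

m+d≤n⇒m/d<n/d : ∀ {a b d} .{{_ : NonZero d}} → a + d ≤ b → a / d < b / d
m+d≤n⇒m/d<n/d {a} {b} {d} a+d≤b = begin-strict
  a / d               <⟨ n<1+n (a / d) ⟩
  suc (a / d)         ≡⟨ cong (λ z → suc (z / d)) (m+n∸n≡m a d) ⟨
  suc ((a + d ∸ d) / d) ≡⟨ m/n≡1+[m∸n]/n (m≤n+m d a) ⟨
  (a + d) / d         ≤⟨ /-monoˡ-≤ d a+d≤b ⟩
  b / d               ∎
  where open ≤-Reasoning

r/d≢[r+D]%N/d : ∀ {r D N d} .{{_ : NonZero N}} .{{_ : NonZero d}} →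
  r < N → d ≤ D → D + d ≤ N → r / d ≢ (r + D) % N / d
r/d≢[r+D]%N/d {r} {D} {N} {d} r<N d≤D D+d≤N with r + D <? N
... | yes r+D<N = <⇒≢ (subst (λ z → r / d < z / d) (sym (m<n⇒m%n≡m r+D<N)) (m+d≤n⇒m/d<n/d (+-monoʳ-≤ r d≤D)))
... | no r+D≮N = >⇒≢ (subst (λ z → z / d < r / d) (sym wrapped) (m+d≤n⇒m/d<n/d y+d≤r))
  where
  N≤r+D : N ≤ r + D
  N≤r+D = ≮⇒≥ r+D≮N
  y : ℕ
  y = r + D ∸ N
  y+d≤r : y + d ≤ r
  y+d≤r = begin
    y + d              ≡⟨ +-∸-comm d N≤r+D ⟨
    r + D + d ∸ N      ≡⟨ cong (_∸ N) (+-assoc r D d) ⟩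
    r + (D + d) ∸ N    ≤⟨ ∸-monoˡ-≤ N (+-monoʳ-≤ r D+d≤N) ⟩
    r + N ∸ N          ≡⟨ m+n∸n≡m r N ⟩
    r                  ∎
    where open ≤-Reasoning
  wrapped : (r + D) % N ≡ y
  wrapped = trans (sym (m≤n⇒[n∸m]%m≡n%m N≤r+D)) (m<n⇒m%n≡m (≤-<-trans (m≤m+n y d) (≤-<-trans y+d≤r r<N)))

floorDiv≡/ : ∀ a b .{{_ : NonZero b}} → floorDiv a b ≡ a / b
floorDiv≡/ a (suc b) = refl

ceilDiv>0 : ∀ {a} b .{{_ : NonZero b}} → 0 < a → 0 < ceilDiv a b
ceilDiv>0 (suc b) 0<a = m≥n⇒m/n>0 (+-monoˡ-≤ b 0<a)

ceilDiv≤ : ∀ a b .{{_ : NonZero b}} → ceilDiv a b ≤ a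
ceilDiv≤ a (suc b) = ≤-pred (m<n*o⇒m/o<n (begin-strict
  a + b                <⟨ +-monoʳ-< a (n<1+n b) ⟩
  a + suc b            ≤⟨ +-monoˡ-≤ (suc b) (m≤m*n a (suc b)) ⟩
  a * suc b + suc b    ≡⟨ +-comm (a * suc b) (suc b) ⟩
  suc a * suc b        ∎))
  where open ≤-Reasoning

≤*ceilDiv : ∀ a b .{{_ : NonZero b}} → a ≤ b * ceilDiv a b
≤*ceilDiv a (suc b) = subst (a ≤_) (*-comm k (suc b)) (+-cancelʳ-≤ b a (k * suc b) (begin
  a + b                          ≡⟨ m≡m%n+[m/n]*n (a + b) (suc b) ⟩
  (a + b) % suc b + k * suc b    ≤⟨ +-monoˡ-≤ (k * suc b) (≤-pred (m%n<n (a + b) (suc b))) ⟩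
  b + k * suc b                  ≡⟨ +-comm b (k * suc b) ⟩
  k * suc b + b                  ∎))
  where
  open ≤-Reasoning
  k : ℕ
  k = (a + b) / suc b

module _ {n : ℕ} where

  private
    N : ℕ
    N = suc n

  toℕ-shift : ∀ (a : Fin N) k → toℕ (shift a k) ≡ (toℕ a + k) % N
  toℕ-shift a k = toℕ-fromℕ< (m%n<n (toℕ a + k) N)

  shift-zero : ∀ (a : Fin N) → shift a 0 ≡ a
  shift-zero a = toℕ-injective (begin
    toℕ (shift a 0)    ≡⟨ toℕ-shift a 0 ⟩
    (toℕ a + 0) % N    ≡⟨ cong (_% N) (+-identityʳ (toℕ a)) ⟩
    toℕ a % N          ≡⟨ m<n⇒m%n≡m (toℕ<n a) ⟩
    toℕ a              ∎)
    where open ≡-Reasoning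

  shift-injective : ∀ (a : Fin N) {u v} → u < N → v < N → shift a u ≡ shift a v → u ≡ v
  shift-injective a {u} {v} u<N v<N eq = begin
    u        ≡⟨ m<n⇒m%n≡m u<N ⟨
    u % N    ≡⟨ %-cancelʳ-+ u v (toℕ a) N eq′ ⟩
    v % N    ≡⟨ m<n⇒m%n≡m v<N ⟩
    v        ∎
    where
    open ≡-Reasoning
    eq′ : (u + toℕ a) % N ≡ (v + toℕ a) % N
    eq′ = begin
      (u + toℕ a) % N    ≡⟨ cong (_% N) (+-comm u (toℕ a)) ⟩
      (toℕ a + u) % N    ≡⟨ toℕ-shift a u ⟨
      toℕ (shift a u)    ≡⟨ cong toℕ eq ⟩
      toℕ (shift a v)    ≡⟨ toℕ-shift a v ⟩
      (toℕ a + v) % N    ≡⟨ cong (_% N) (+-comm (toℕ a) v) ⟩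
      (v + toℕ a) % N    ∎

  shift-cancel : ∀ (a b : Fin N) {u v} → u ≤ v → shift a u ≡ shift b v → a ≡ shift b (v ∸ u)
  shift-cancel a b {u} {v} u≤v eq = toℕ-injective (begin
    toℕ a                     ≡⟨ m<n⇒m%n≡m (toℕ<n a) ⟨
    toℕ a % N                 ≡⟨ %-cancelʳ-+ (toℕ a) (toℕ b + (v ∸ u)) u N eq′ ⟩
    (toℕ b + (v ∸ u)) % N     ≡⟨ toℕ-shift b (v ∸ u) ⟨
    toℕ (shift b (v ∸ u))     ∎)
    where
    open ≡-Reasoning
    eq′ : (toℕ a + u) % N ≡ (toℕ b + (v ∸ u) + u) % N
    eq′ = begin
      (toℕ a + u) % N              ≡⟨ toℕ-shift a u ⟨
      toℕ (shift a u)              ≡⟨ cong toℕ eq ⟩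
      toℕ (shift b v)              ≡⟨ toℕ-shift b v ⟩
      (toℕ b + v) % N              ≡⟨ cong (λ w → (toℕ b + w) % N) (m∸n+n≡m u≤v) ⟨
      (toℕ b + (v ∸ u + u)) % N    ≡⟨ cong (_% N) (+-assoc (toℕ b) (v ∸ u) u) ⟨
      (toℕ b + (v ∸ u) + u) % N    ∎

  offset : Fin N → Fin N → ℕ
  offset a x = (toℕ x + (N ∸ toℕ a)) % N

  offset<N : ∀ a x → offset a x < N
  offset<N a x = m%n<n (toℕ x + (N ∸ toℕ a)) N

  shift-offset : ∀ a x → shift a (offset a x) ≡ x
  shift-offset a x = toℕ-injective (begin
    toℕ (shift a (offset a x))             ≡⟨ toℕ-shift a (offset a x) ⟩
    (toℕ a + offset a x) % N               ≡⟨ [m+n%d]%d≡[m+n]%d (toℕ a) (toℕ x + (N ∸ toℕ a)) N ⟩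
    (toℕ a + (toℕ x + (N ∸ toℕ a))) % N    ≡⟨ cong (_% N) (x∙yz≈y∙xz (toℕ a) (toℕ x) (N ∸ toℕ a)) ⟩
    (toℕ x + (toℕ a + (N ∸ toℕ a))) % N    ≡⟨ cong (λ w → (toℕ x + w) % N) (m+[n∸m]≡n (<⇒≤ (toℕ<n a))) ⟩
    (toℕ x + N) % N                        ≡⟨ [m+n]%n≡m%n (toℕ x) N ⟩
    toℕ x % N                              ≡⟨ m<n⇒m%n≡m (toℕ<n x) ⟩
    toℕ x                                  ∎)
    where open ≡-Reasoning

  ∈T⇒shift : ∀ {t} (a : Fin N) {x} → x ∈ₛ T t a → ∃[ k ] k < t × shift a k ≡ x
  ∈T⇒shift {t} a {x} x∈T =
    let k , k∈upTo , hit = find (any⁻ (reaches x) (upTo t) (Equivalence.from T-≡ any≡true))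
    in k , ∈-upTo⁻ k∈upTo , toWitness hit
    where
    reaches : Fin N → ℕ → Bool
    reaches y k = ⌊ shift a k ≟ᶠ y ⌋
    any≡true : any (reaches x) (upTo t) ≡ true
    any≡true = trans (sym (lookup∘tabulate (λ y → any (reaches y) (upTo t)) x)) ([]=⇒lookup x∈T)

  shift⇒∈T : ∀ {t k} (a : Fin N) → k < t → shift a k ∈ₛ T t a
  shift⇒∈T {t} {k} a k<t = lookup⇒[]= (shift a k) (T t a) (trans
    (lookup∘tabulate (λ y → any (reaches y) (upTo t)) (shift a k))
    (Equivalence.to T-≡ (any⁺ (reaches (shift a k)) (lose (∈-upTo⁺ k<t) (fromWitness refl)))))
    where
    reaches : Fin N → ℕ → Bool
    reaches y k = ⌊ shift a k ≟ᶠ y ⌋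

  ∈T⇒offset< : ∀ {t} (a x : Fin N) → t ≤ N → x ∈ₛ T t a → offset a x < t
  ∈T⇒offset< {t} a x t≤N x∈T =
    let k , k<t , shift≡x = ∈T⇒shift {t} a x∈T
    in subst (_< _) (shift-injective a (≤-trans k<t t≤N) (offset<N a x) (trans shift≡x (sym (shift-offset a x)))) k<t

  offset<⇒∈T : ∀ {t} (a x : Fin N) → offset a x < t → x ∈ₛ T t a
  offset<⇒∈T a x lt = subst (_∈ₛ _) (shift-offset a x) (shift⇒∈T a lt)

  class : (m : ℕ) .{{_ : NonZero m}} → Fin N → ℕ
  class m y = toℕ y * m % N / m

  class<ceilDiv : ∀ m .{{_ : NonZero m}} y → class m y < ceilDiv N m
  class<ceilDiv (suc m) y =
    m+d≤n⇒m/d<n/d (subst (_≤ N + m) (sym (+-suc (toℕ y * suc m % N) m)) (+-monoˡ-≤ m (m%n<n (toℕ y * suc m) N)))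

  class-shift : ∀ m .{{_ : NonZero m}} (b : Fin N) k → class m (shift b k) ≡ (toℕ b * m % N + k * m) % N / m
  class-shift m b k = cong (_/ m) (begin
    toℕ (shift b k) * m % N         ≡⟨ cong (λ z → z * m % N) (toℕ-shift b k) ⟩
    (toℕ b + k) % N * m % N         ≡⟨ [m%d*n]%d≡[m*n]%d (toℕ b + k) m N ⟩
    (toℕ b + k) * m % N             ≡⟨ cong (_% N) (*-distribʳ-+ m (toℕ b) k) ⟩
    (toℕ b * m + k * m) % N         ≡⟨ [m%d+n]%d≡[m+n]%d (toℕ b * m) (k * m) N ⟨
    (toℕ b * m % N + k * m) % N     ∎)
    where open ≡-Reasoning

  sameClass⇒shift≡ : ∀ {m χ} .{{_ : NonZero m}} → χ * m ≤ N →
    ∀ (b : Fin N) {k} → k < χ → class m (shift b k) ≡ class m b → shift b k ≡ b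
  sameClass⇒shift≡ χm≤N b {zero} _ _ = shift-zero b
  sameClass⇒shift≡ {m} {χ} χm≤N b {suc k} k<χ eq =
    contradiction (trans (sym eq) (class-shift m b (suc k))) (r/d≢[r+D]%N/d (m%n<n (toℕ b * m) N) (m≤m+n m (k * m)) jump≤)
    where
    open ≤-Reasoning
    jump≤ : suc k * m + m ≤ N
    jump≤ = begin
      suc k * m + m        ≡⟨ +-comm (suc k * m) m ⟩
      suc (suc k) * m      ≤⟨ *-monoˡ-≤ m k<χ ⟩
      χ * m                ≤⟨ χm≤N ⟩
      N                    ∎

  sameClass⇒separated : ∀ {m χ} .{{_ : NonZero m}} → χ * m ≤ N → ∀ {a b : Fin N} {u v} →
    class m a ≡ class m b → u ≤ v → v < u + χ → shift a u ≡ shift b v → a ≡ b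
  sameClass⇒separated {m} {χ} χm≤N {a} {b} {u} {v} eq u≤v v<u+χ shifts≡ =
    trans a≡ (sameClass⇒shift≡ χm≤N b v∸u<χ (trans (cong (class m) (sym a≡)) eq))
    where
    a≡ : a ≡ shift b (v ∸ u)
    a≡ = shift-cancel a b u≤v shifts≡
    v∸u<χ : v ∸ u < χ
    v∸u<χ = subst (v ∸ u <_) (m+n∸m≡n u χ) (∸-monoˡ-< v<u+χ u≤v)

  sameClass⇒offsets-separated : ∀ {l m χ} .{{_ : NonZero m}} → χ * m ≤ N →
    {a : Fin l → Fin N} → Injective _≡_ _≡_ a → (∀ i j → class m (a i) ≡ class m (a j)) →
    ∀ x p → SeparatedOn χ (λ i → offset (a i) x) p
  sameClass⇒offsets-separated χm≤N {a} a-injective sameClass x p {i} {j} _ _ u≤v v<u+χ =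
    a-injective (sameClass⇒separated χm≤N (sameClass i j) u≤v v<u+χ
      (trans (shift-offset (a i) x) (sym (shift-offset (a j) x))))

  sameClass⇒Disjoint : ∀ {l m χ} .{{_ : NonZero m}} .{{_ : NonZero χ}} (t s₁ s₂ : ℕ) →
    χ * m ≤ N → t ≤ N → t ≤ s₁ * χ → N ∸ t ≤ s₂ * χ →
    {a : Fin l → Fin N} → Injective _≡_ _≡_ a → (∀ i j → class m (a i) ≡ class m (a j)) →
    Disjoint (s₁ + 1) (s₂ + 1) (T t ∘ a)
  sameClass⇒Disjoint {χ = χ} t s₁ s₂ χm≤N t≤N t≤s₁χ N∸t≤s₂χ {a} a-injective sameClass = noCommonPoint , covering
    where
    separated : ∀ x p → SeparatedOn χ (λ i → offset (a i) x) p
    separated = sameClass⇒offsets-separated χm≤N a-injective sameClass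

    noCommonPoint : ∀ B → ∣ B ∣ ≡ s₁ + 1 → ∀ x → ¬ (∀ i → i ∈ₛ B → x ∈ₛ T t (a i))
    noCommonPoint B ∣B∣≡ x x∈all = m+1+n≰m s₁ (subst (_≤ s₁) ∣B∣≡ (separated⇒∣p∣≤ 0 s₁ (separated x B)
      (λ {i} i∈B → z≤n , ≤-trans (∈T⇒offset< (a i) x t≤N (x∈all i i∈B)) t≤s₁χ)))

    covering : ∀ B → ∣ B ∣ ≡ s₂ + 1 → ∀ x → ∃[ i ] (i ∈ₛ B × x ∈ₛ T t (a i))
    covering B ∣B∣≡ x with any? (λ i → i ∈? B ×-dec x ∈? T t (a i))
    ... | yes found = found
    ... | no none = contradiction (subst (_≤ s₂) ∣B∣≡ (separated⇒∣p∣≤ t s₂ (separated x B) window)) (m+1+n≰m s₂)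
      where
      t≤offset : ∀ {i} → i ∈ₛ B → t ≤ offset (a i) x
      t≤offset {i} i∈B = ≮⇒≥ (λ lt → none (i , i∈B , offset<⇒∈T (a i) x lt))
      window : ∀ {i} → i ∈ₛ B → t ≤ offset (a i) x × offset (a i) x ∸ t < s₂ * χ
      window {i} i∈B = t≤offset i∈B , ≤-trans (∸-monoˡ-< (offset<N (a i) x) (t≤offset i∈B)) N∸t≤s₂χ

  sameClass-count : ∀ {m χ} .{{_ : NonZero m}} .{{_ : NonZero χ}} (t λ' s₁ s₂ : ℕ) →
    χ * m ≤ N → t ≤ N → t ≤ s₁ * χ → N ∸ t ≤ s₂ * χ →
    (S : List (Subset N)) → Unique S → All (λ A → ∃[ a ] A ≡ T t a) S →
    ¬ (∃[ A ] (((i : Fin λ') → A i ∈ S) × Disjoint (s₁ + 1) (s₂ + 1) A)) →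
    length S ≤ (λ' ∸ 1) * ceilDiv N m
  sameClass-count {m} t λ' s₁ s₂ χm≤N t≤N t≤s₁χ N∸t≤s₂χ S S! S⊆T noDisjoint
    with L , refl ← All-∃≡⇒≡map S⊆T = begin
    length (map (T t) L)      ≡⟨ length-map (T t) L ⟩
    length L                  ≤⟨ fibres≤⇒length≤ (class m) (ceilDiv N m) (λ' ∸ 1) (All.universal (class<ceilDiv m) L) fibre≤ ⟩
    ceilDiv N m * (λ' ∸ 1)    ≡⟨ *-comm (ceilDiv N m) (λ' ∸ 1) ⟩
    (λ' ∸ 1) * ceilDiv N m    ∎
    where
    open ≤-Reasoning
    fibre≤ : ∀ r → r < ceilDiv N m → length (filter (λ y → class m y ≟ r) L) ≤ λ' ∸ 1
    fibre≤ r _ with λ' ≤? length (filter (λ y → class m y ≟ r) L)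
    ... | no λ'≰ = ∸-monoˡ-≤ 1 (≰⇒> λ'≰)
    ... | yes λ'≤ = contradiction (T t ∘ a , (λ i → ∈-map⁺ (T t) (proj₁ (a∈ i))) ,
                      sameClass⇒Disjoint t s₁ s₂ χm≤N t≤N t≤s₁χ N∸t≤s₂χ a-injective
                        (λ i j → trans (proj₂ (a∈ i)) (sym (proj₂ (a∈ j))))) noDisjoint
      where
      a : Fin λ' → Fin N
      a i = lookup (filter (λ y → class m y ≟ r) L) (inject≤ i λ'≤)
      a∈ : ∀ i → a i ∈ L × class m (a i) ≡ r
      a∈ i = ∈-filter⁻ (λ y → class m y ≟ r) (∈-lookup (inject≤ i λ'≤))
      a-injective : Injective _≡_ _≡_ a
      a-injective = inject≤-injective λ'≤ λ'≤ _ _ ∘ Unique⇒lookup-injective (Unique-filter⁺ _ (Unique-map⁻ S!))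

lemma5p2 : (n t λ' s₁ s₂ : ℕ) → 1 ≤ s₁ → 1 ≤ s₂ → 1 < t → t < n →
  (s₁ + 1) ⊓ (s₂ + 1) ≤ λ' → λ' ≤ s₁ + s₂ →
  (S : List (Subset n)) → Unique S → All (λ A → ∃[ a ] A ≡ T t a) S →
  (¬ (∃[ A ] (((i : Fin λ') → A i ∈ S) × Disjoint {n} {λ'} (s₁ + 1) (s₂ + 1) A))) →
  length S ≤ (λ' ∸ 1) * ceilDiv n (floorDiv n (ceilDiv t s₁ ⊔ ceilDiv (n ∸ t) s₂))
lemma5p2 n t λ' s₁ s₂ 1≤s₁ 1≤s₂ 1<t t<n@(s≤s _) _ _ S S! S⊆T noDisjoint =
  subst (λ m → length S ≤ (λ' ∸ 1) * ceilDiv n m) (sym (floorDiv≡/ n χ))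
    (sameClass-count t λ' s₁ s₂ χ[n/χ]≤n (<⇒≤ t<n) t≤s₁χ n∸t≤s₂χ S S! S⊆T noDisjoint)
  where
  instance
    s₁≢0 : NonZero s₁
    s₁≢0 = >-nonZero 1≤s₁
    s₂≢0 : NonZero s₂
    s₂≢0 = >-nonZero 1≤s₂
  χ : ℕ
  χ = ceilDiv t s₁ ⊔ ceilDiv (n ∸ t) s₂
  χ≤n : χ ≤ n
  χ≤n = ⊔-lub (≤-trans (ceilDiv≤ t s₁) (<⇒≤ t<n)) (≤-trans (ceilDiv≤ (n ∸ t) s₂) (m∸n≤m n t))
  instance
    χ≢0 : NonZero χ
    χ≢0 = >-nonZero (≤-trans (ceilDiv>0 s₁ (<⇒≤ 1<t)) (m≤m⊔n _ _))
    n/χ≢0 : NonZero (n / χ)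
    n/χ≢0 = >-nonZero (m≥n⇒m/n>0 χ≤n)
  χ[n/χ]≤n : χ * (n / χ) ≤ n
  χ[n/χ]≤n = subst (_≤ n) (*-comm (n / χ) χ) (m/n*n≤m n χ)
  t≤s₁χ : t ≤ s₁ * χ
  t≤s₁χ = ≤-trans (≤*ceilDiv t s₁) (*-monoʳ-≤ s₁ (m≤m⊔n _ _))
  n∸t≤s₂χ : n ∸ t ≤ s₂ * χ
  n∸t≤s₂χ = ≤-trans (≤*ceilDiv (n ∸ t) s₂) (*-monoʳ-≤ s₂ (m≤n⊔m _ _))
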